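{- If the last rule of a MALL$^\ast$ proof generates the formula occurrence $A$, then $A$ separates the associated proof net.
   Context: Setting: MALL$^\ast$ (MALL with cut formulas $A\ast A^\perp$ retained in sequents; the cut rule derives $\Gamma,A\ast A^\perp,\Delta$ from $\Gamma,A$ and $A^\perp,\Delta$; the $\&$-rule derives $\Omega_1,\Omega_2,\Gamma,A\&B$ from $\Omega_1,\Gamma,A$ and $\Omega_2,\Gamma,B$ with $\Omega_i$ cut-only). A formula occurrence in the conclusion of a rule is generated by that rule if it is not the image of any occurrence in the hypotheses under the implicit downward tracking. The proof net of a proof $\Pi$ is $\theta_\Pi=\{\lambda_R\}$ over $\&$-resolutions $R$ (delete one branch above each $\&$-rule; $\lambda_R$ is the set of links, i.e. pairs of leaves, given by the axioms of $R$). For a set $\Lambda$ of linkings on $\Gamma$: $\Gamma{\restriction}\Lambda$ is the forest $\Gamma$ with all vertices deleted that are not below a leaf occurring in some link of $\Lambda$; a $\&$-vertex $w$ is toggled by $\Lambda$ if both its arguments occur in $\Gamma{\restriction}\Lambda$; a link $a$ depends on $w$ in $\Lambda$ if there are $\lambda,\lambda'\in\Lambda$ with $a\in\lambda$, $a\notin\lambda'$ and $w$ the only $\&$-vertex toggled by $\{\lambda,\lambda'\}$. The graph $G(\Lambda)$ is $\Gamma{\restriction}\Lambda$ plus the edges of all links in $\bigcup\Lambda$ plus jump edges from leaves $\ell,\ell'$ to every $\&$-vertex on which the link $\{\ell,\ell'\}$ depends. A formula occurrence $A=A_1\,\alpha\,A_2$ separates a proof net $\theta$ if (i) $\alpha$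 is par ($⅋$) or $\&$, (ii) $\alpha=\oplus$ and one of the $A_i$ does not occur in $G(\theta)$, or (iii) $\alpha\in\{\otimes,\ast\}$ and $G(\theta)$ has no cycle through the $\alpha$-vertex. -}

module Defs where

open import Data.Nat using (ℕ; zero; suc; _+_; _≤_)
open import Data.Bool using (Bool; true; false; not)
open import Data.Fin using (Fin; zero; suc; splitAt; _↑ˡ_; _↑ʳ_)
open import Data.Sum using (_⊎_; inj₁; inj₂)
open import Data.Product using (Σ; ∃; _×_; _,_; proj₁; proj₂)
open import Data.Maybe using (Maybe; just; nothing)
open import Data.List using (List; []; _∷_; _∷ʳ_; map; concatMap; length)
import Data.List as List
open import Data.List.Membership.Propositional using (_∈_)
open import Data.List.Relation.Unary.All using (All)
open import Data.List.Relation.Unary.Linked using (Linked)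
open import Data.List.Relation.Unary.Unique.Propositional using (Unique)
open import Data.Vec.Functional using (Vector; _++_)
open import Data.Empty using (⊥)
open import Data.Unit using (⊤)
open import Function.Bundles using (_↔_; Inverse)
open import Relation.Nullary using (¬_)
open import Relation.Binary.PropositionalEquality using (_≡_)

-- Unit-free MALL formulas.  atom true p = p, atom false p = p⊥.

data Formula : Set where
  atom : Bool → ℕ → Formula
  _⊗_ _⅋_ _⊕_ _&_ : Formula → Formula → Formula

dual : Formula → Formula
dual (atom b p) = atom (not b) p
dual (A ⊗ B) = dual A ⅋ dual B
dual (A ⅋ B) = dual A ⊗ dual B
dual (A ⊕ B) = dual A & dual B
dual (A & B) = dual A ⊕ dual B

data Item : Set where
  fml : Formula → Item
  cut : Formula → Item      -- cut A  represents  A ∗ A⊥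

data IsCut : Item → Set where
  isCut : ∀ A → IsCut (cut A)

⟦_⟧ : Item → Vector Item 1
⟦ x ⟧ _ = x

-- Formula-occurrence trees.  A vertex of the forest of a sequent is a
-- position in the sequent together with a path from the root
-- (lft = first argument, rgt = second argument).

data Dir : Set where
  lft rgt : Dir

Path : Set
Path = List Dir

data Label : Set where
  leafL tensL parL plusL withL cutL : Label

labF : Formula → Path → Maybe Label
labF (atom _ _) [] = just leafL
labF (atom _ _) (_ ∷ _) = nothing
labF (A ⊗ B) [] = just tensL
labF (A ⅋ B) [] = just parL
labF (A ⊕ B) [] = just plusL
labF (A & B) [] = just withL
labF (A ⊗ B) (lft ∷ p) = labF A p
labF (A ⊗ B) (rgt ∷ p) = labF B p
labF (A ⅋ B) (lft ∷ p) = labF A p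
labF (A ⅋ B) (rgt ∷ p) = labF B p
labF (A ⊕ B) (lft ∷ p) = labF A p
labF (A ⊕ B) (rgt ∷ p) = labF B p
labF (A & B) (lft ∷ p) = labF A p
labF (A & B) (rgt ∷ p) = labF B p

lab : Item → Path → Maybe Label
lab (fml A) p = labF A p
lab (cut A) [] = just cutL
lab (cut A) (lft ∷ p) = labF A p
lab (cut A) (rgt ∷ p) = labF (dual A) p

Vertex : ℕ → Set
Vertex n = Fin n × Path

module _ {n : ℕ} (Δ : Vector Item n) where
  labelOf : Vertex n → Maybe Label
  labelOf (i , p) = lab (Δ i) p

  IsVertex : Vertex n → Set
  IsVertex v = ∃ λ l → labelOf v ≡ just l

  IsLeaf IsWith : Vertex n → Set
  IsLeaf v = labelOf v ≡ just leafL
  IsWith v = labelOf v ≡ just withL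

child : ∀ {n} → Vertex n → Dir → Vertex n
child (i , p) d = (i , p ∷ʳ d)

-- Each rule builds a canonical conclusion which may be
-- arbitrarily permuted: the conclusion Δ satisfies Δ (to π c) ≡ canon c,
-- i.e. canonical position c is sent to position  to π c  of Δ.

Perm : ℕ → Set
Perm n = Fin n ↔ Fin n

Arr : ∀ {n} → Perm n → Vector Item n → Vector Item n → Set
Arr π Δ canon = ∀ c → Δ (Inverse.to π c) ≡ canon c

data Proof : {n : ℕ} → Vector Item n → Set where
  axR : ∀ {Δ : Vector Item 2} (p : ℕ) (π : Perm 2) →
        Arr π Δ (⟦ fml (atom true p) ⟧ ++ ⟦ fml (atom false p) ⟧) → Proof Δ
  parR : ∀ {m} {Γ : Vector Item m} {A B} {Δ : Vector Item (m + 1)} (π : Perm (m + 1)) →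
         Arr π Δ (Γ ++ ⟦ fml (A ⅋ B) ⟧) →
         Proof (Γ ++ (⟦ fml A ⟧ ++ ⟦ fml B ⟧)) → Proof Δ
  tensR : ∀ {m k} {Γ : Vector Item m} {Γ' : Vector Item k} {A B}
          {Δ : Vector Item ((m + k) + 1)} (π : Perm ((m + k) + 1)) →
          Arr π Δ ((Γ ++ Γ') ++ ⟦ fml (A ⊗ B) ⟧) →
          Proof (Γ ++ ⟦ fml A ⟧) → Proof (Γ' ++ ⟦ fml B ⟧) → Proof Δ
  plus1R : ∀ {m} {Γ : Vector Item m} {A B} {Δ : Vector Item (m + 1)} (π : Perm (m + 1)) →
           Arr π Δ (Γ ++ ⟦ fml (A ⊕ B) ⟧) → Proof (Γ ++ ⟦ fml A ⟧) → Proof Δ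
  plus2R : ∀ {m} {Γ : Vector Item m} {A B} {Δ : Vector Item (m + 1)} (π : Perm (m + 1)) →
           Arr π Δ (Γ ++ ⟦ fml (A ⊕ B) ⟧) → Proof (Γ ++ ⟦ fml B ⟧) → Proof Δ
  withR : ∀ {o₁ o₂ m} {Ω₁ : Vector Item o₁} {Ω₂ : Vector Item o₂} {Γ : Vector Item m} {A B}
          {Δ : Vector Item (((o₁ + o₂) + m) + 1)} (π : Perm (((o₁ + o₂) + m) + 1)) →
          (∀ i → IsCut (Ω₁ i)) → (∀ i → IsCut (Ω₂ i)) →
          Arr π Δ (((Ω₁ ++ Ω₂) ++ Γ) ++ ⟦ fml (A & B) ⟧) →
          Proof ((Ω₁ ++ Γ) ++ ⟦ fml A ⟧) → Proof ((Ω₂ ++ Γ) ++ ⟦ fml B ⟧) → Proof Δ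
  cutR : ∀ {m k} {Γ : Vector Item m} {Γ' : Vector Item k} {A}
         {Δ : Vector Item ((m + k) + 1)} (π : Perm ((m + k) + 1)) →
         Arr π Δ ((Γ ++ Γ') ++ ⟦ cut A ⟧) →
         Proof (Γ ++ ⟦ fml A ⟧) → Proof (⟦ fml (dual A) ⟧ ++ Γ') → Proof Δ

-- Downward tracking of occurrences (hypothesis vertex ↦ conclusion vertex).

module Track where
  to : ∀ {n} → Perm n → Fin n → Fin n
  to π = Inverse.to π

  -- single-premise rules with hypothesis Γ ++ ⟦ A ⟧, principal argument d
  unary : ∀ m → Perm (m + 1) → Dir → Vertex (m + 1) → Vertex (m + 1)
  unary m π d (j , p) with splitAt m j
  ... | inj₁ k = (to π (k ↑ˡ 1) , p)
  ... | inj₂ _ = (to π (m ↑ʳ zero) , d ∷ p)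

  par : ∀ m → Perm (m + 1) → Vertex (m + 2) → Vertex (m + 1)
  par m π (j , p) with splitAt m {2} j
  ... | inj₁ k = (to π (k ↑ˡ 1) , p)
  ... | inj₂ zero = (to π (m ↑ʳ zero) , lft ∷ p)
  ... | inj₂ (suc _) = (to π (m ↑ʳ zero) , rgt ∷ p)

  left : ∀ m k → Perm ((m + k) + 1) → Vertex (m + 1) → Vertex ((m + k) + 1)
  left m k π (j , p) with splitAt m j
  ... | inj₁ i = (to π ((i ↑ˡ k) ↑ˡ 1) , p)
  ... | inj₂ _ = (to π ((m + k) ↑ʳ zero) , lft ∷ p)

  tensRight : ∀ m k → Perm ((m + k) + 1) → Vertex (k + 1) → Vertex ((m + k) + 1)
  tensRight m k π (j , p) with splitAt k j
  ... | inj₁ i = (to π ((m ↑ʳ i) ↑ˡ 1) , p)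
  ... | inj₂ _ = (to π ((m + k) ↑ʳ zero) , rgt ∷ p)

  cutRight : ∀ m k → Perm ((m + k) + 1) → Vertex (1 + k) → Vertex ((m + k) + 1)
  cutRight m k π (zero , p) = (to π ((m + k) ↑ʳ zero) , rgt ∷ p)
  cutRight m k π (suc i , p) = (to π ((m ↑ʳ i) ↑ˡ 1) , p)

  with1 : ∀ o₁ o₂ m → Perm (((o₁ + o₂) + m) + 1) → Vertex ((o₁ + m) + 1) →
          Vertex (((o₁ + o₂) + m) + 1)
  with1 o₁ o₂ m π (j , p) with splitAt (o₁ + m) j
  ... | inj₂ _ = (to π (((o₁ + o₂) + m) ↑ʳ zero) , lft ∷ p)
  ... | inj₁ k with splitAt o₁ k
  ...   | inj₁ a = (to π (((a ↑ˡ o₂) ↑ˡ m) ↑ˡ 1) , p)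
  ...   | inj₂ g = (to π (((o₁ + o₂) ↑ʳ g) ↑ˡ 1) , p)

  with2 : ∀ o₁ o₂ m → Perm (((o₁ + o₂) + m) + 1) → Vertex ((o₂ + m) + 1) →
          Vertex (((o₁ + o₂) + m) + 1)
  with2 o₁ o₂ m π (j , p) with splitAt (o₂ + m) j
  ... | inj₂ _ = (to π (((o₁ + o₂) + m) ↑ʳ zero) , rgt ∷ p)
  ... | inj₁ k with splitAt o₂ k
  ...   | inj₁ a = (to π (((o₁ ↑ʳ a) ↑ˡ m) ↑ˡ 1) , p)
  ...   | inj₂ g = (to π (((o₁ + o₂) ↑ʳ g) ↑ˡ 1) , p)

Image : ∀ {n} {Δ : Vector Item n} → Proof Δ → Vertex n → Set
Image (axR p π x) v = ⊥
Image (parR {m} {Γ} {A} {B} π x P) v =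
  Σ (Vertex (m + 2)) λ u → IsVertex (Γ ++ (⟦ fml A ⟧ ++ ⟦ fml B ⟧)) u × Track.par m π u ≡ v
Image (tensR {m} {k} {Γ} {Γ'} {A} {B} π x P Q) v =
  (Σ (Vertex (m + 1)) λ u → IsVertex (Γ ++ ⟦ fml A ⟧) u × Track.left m k π u ≡ v) ⊎
  (Σ (Vertex (k + 1)) λ u → IsVertex (Γ' ++ ⟦ fml B ⟧) u × Track.tensRight m k π u ≡ v)
Image (plus1R {m} {Γ} {A} π x P) v =
  Σ (Vertex (m + 1)) λ u → IsVertex (Γ ++ ⟦ fml A ⟧) u × Track.unary m π lft u ≡ v
Image (plus2R {m} {Γ} {A} {B} π x P) v =
  Σ (Vertex (m + 1)) λ u → IsVertex (Γ ++ ⟦ fml B ⟧) u × Track.unary m π rgt u ≡ v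
Image (withR {o₁} {o₂} {m} {Ω₁} {Ω₂} {Γ} {A} {B} π c₁ c₂ x P Q) v =
  (Σ (Vertex ((o₁ + m) + 1)) λ u → IsVertex ((Ω₁ ++ Γ) ++ ⟦ fml A ⟧) u × Track.with1 o₁ o₂ m π u ≡ v) ⊎
  (Σ (Vertex ((o₂ + m) + 1)) λ u → IsVertex ((Ω₂ ++ Γ) ++ ⟦ fml B ⟧) u × Track.with2 o₁ o₂ m π u ≡ v)
Image (cutR {m} {k} {Γ} {Γ'} {A} π x P Q) v =
  (Σ (Vertex (m + 1)) λ u → IsVertex (Γ ++ ⟦ fml A ⟧) u × Track.left m k π u ≡ v) ⊎
  (Σ (Vertex (1 + k)) λ u → IsVertex (⟦ fml (dual A) ⟧ ++ Γ') u × Track.cutRight m k π u ≡ v)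

Generated : ∀ {n} {Δ : Vector Item n} → Proof Δ → Vertex n → Set
Generated {Δ = Δ} P v = IsVertex Δ v × ¬ Image P v

Link : ℕ → Set
Link n = Vertex n × Vertex n

_∈ₗ_ : ∀ {n} → Link n → List (Link n) → Set
(x , y) ∈ₗ λ' = ((x , y) ∈ λ') ⊎ ((y , x) ∈ λ')

trackLink : ∀ {h n} → (Vertex h → Vertex n) → Link h → Link n
trackLink f (x , y) = (f x , f y)

-- the linkings λ_R of all &-resolutions R (one entry per resolution)
linkings : ∀ {n} {Δ : Vector Item n} → Proof Δ → List (List (Link n))
linkings (axR p π x) = (((Inverse.to π zero , []) , (Inverse.to π (suc zero) , [])) ∷ []) ∷ []
linkings (parR {m} π x P) = map (map (trackLink (Track.par m π))) (linkings P)
linkings (tensR {m} {k} π x P Q) =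
  concatMap (λ l₁ → map (λ l₂ → map (trackLink (Track.left m k π)) l₁ List.++
                                 map (trackLink (Track.tensRight m k π)) l₂) (linkings Q))
            (linkings P)
linkings (plus1R {m} π x P) = map (map (trackLink (Track.unary m π lft))) (linkings P)
linkings (plus2R {m} π x P) = map (map (trackLink (Track.unary m π rgt))) (linkings P)
linkings (withR {o₁} {o₂} {m} π c₁ c₂ x P Q) =
  map (map (trackLink (Track.with1 o₁ o₂ m π))) (linkings P) List.++
  map (map (trackLink (Track.with2 o₁ o₂ m π))) (linkings Q)
linkings (cutR {m} {k} π x P Q) =
  concatMap (λ l₁ → map (λ l₂ → map (trackLink (Track.left m k π)) l₁ List.++
                                 map (trackLink (Track.cutRight m k π)) l₂) (linkings Q))
            (linkings P)

LinkingSet : ℕ → Set₁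
LinkingSet n = List (Link n) → Set

θ : ∀ {n} {Δ : Vector Item n} → Proof Δ → LinkingSet n
θ P λ' = λ' ∈ linkings P

pairSet : ∀ {n} → List (Link n) → List (Link n) → LinkingSet n
pairSet λ₁ λ₂ μ = (μ ≡ λ₁) ⊎ (μ ≡ λ₂)

module _ {n : ℕ} (Δ : Vector Item n) where

  Below : Vertex n → Vertex n → Set
  Below (i , p) (j , q) = (i ≡ j) × ∃ λ r → q ≡ p List.++ r

  InRestr : LinkingSet n → Vertex n → Set
  InRestr Λ v = IsVertex Δ v × ∃ λ λ' → Λ λ' × ∃ λ a → a ∈ λ' ×
                (Below v (proj₁ a) ⊎ Below v (proj₂ a))

  Toggled : LinkingSet n → Vertex n → Set
  Toggled Λ w = IsWith Δ w × InRestr Λ (child w lft) × InRestr Λ (child w rgt)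

  Depends : LinkingSet n → Link n → Vertex n → Set
  Depends Λ a w = ∃ λ λ₁ → ∃ λ λ₂ → Λ λ₁ × Λ λ₂ × a ∈ₗ λ₁ × ¬ (a ∈ₗ λ₂) ×
                  Toggled (pairSet λ₁ λ₂) w ×
                  (∀ w' → Toggled (pairSet λ₁ λ₂) w' → w' ≡ w)

  InUnion : LinkingSet n → Link n → Set
  InUnion Λ a = ∃ λ λ' → Λ λ' × a ∈ₗ λ'

  data Edge (Λ : LinkingSet n) : Vertex n → Vertex n → Set where
    tree : ∀ v d → InRestr Λ v → InRestr Λ (child v d) → Edge Λ v (child v d)
    link : ∀ x y → InUnion Λ (x , y) → Edge Λ x y
    jump : ∀ ℓ ℓ' w → InUnion Λ (ℓ , ℓ') → Depends Λ (ℓ , ℓ') w → Edge Λ ℓ w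

  Adj : LinkingSet n → Vertex n → Vertex n → Set
  Adj Λ u v = Edge Λ u v ⊎ Edge Λ v u

  CycleThrough : LinkingSet n → Vertex n → Set
  CycleThrough Λ x = ∃ λ (vs : List (Vertex n)) → 2 ≤ length vs ×
                     Unique (x ∷ vs) × All (InRestr Λ) (x ∷ vs) ×
                     Linked (Adj Λ) ((x ∷ vs) ∷ʳ x)

  SepBy : Maybe Label → LinkingSet n → Vertex n → Set
  SepBy (just parL) Λ v = ⊤
  SepBy (just withL) Λ v = ⊤
  SepBy (just plusL) Λ v = ¬ InRestr Λ (child v lft) ⊎ ¬ InRestr Λ (child v rgt)
  SepBy (just tensL) Λ v = ¬ CycleThrough Λ v
  SepBy (just cutL) Λ v = ¬ CycleThrough Λ v
  SepBy (just leafL) Λ v = ⊥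
  SepBy nothing Λ v = ⊥

  Separates : LinkingSet n → Vertex n → Set
  Separates Λ v = SepBy (labelOf Δ v) Λ v

  Compound : Vertex n → Set
  Compound v = IsVertex Δ v × ¬ IsLeaf Δ v

module Submission where

-- Let the last rule of Π generate the occurrence v.  Every
-- occurrence of the conclusion other than the principal formula (and, for
-- ⊕, the unused argument subtree) is the image of a hypothesis occurrence,
-- so v is the principal formula or, for ⊕, lies in the discarded argument.
--   * ⅋ and & separate by definition; an axiom has no compound occurrence.
--   * ⊕: every link of θ_Π comes from the premise, so nothing in the
--     discarded argument belongs to Γ↾θ_Π, which is separation for v.
--   * ⊗ and cut: G(θ_Π) has no cycle through v.  Every vertex other than v
--     lies on the side of the left or of the right premise, and edges not
--     touching v never change side: tree and axiom edges obviously, jump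
--     edges because of the proof-net invariant "two linkings that differ
--     on a link toggle some &-vertex" (each side toggles one of its own).
--     The only edges at v go to its two children, which lie on opposite
--     sides, so a cycle through v would have to return to the same child.

open import Defs
open import Data.Bool using (true; false)
open import Data.Nat using (ℕ; zero; suc; _+_; s≤s)
open import Data.Fin using (Fin; zero; suc; splitAt; _↑ˡ_; _↑ʳ_)
open import Data.Fin.Properties using (splitAt-↑ˡ; splitAt-↑ʳ; splitAt⁻¹-↑ˡ; splitAt⁻¹-↑ʳ)
open import Data.Sum using (_⊎_; inj₁; inj₂; [_,_]′) renaming (map to map⊎)
open import Data.Product using (Σ; ∃; _×_; _,_; proj₁; proj₂)
open import Data.Maybe using (just; nothing)
open import Data.List using (List; []; _∷_; _∷ʳ_; map; concatMap)
import Data.List as List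
open import Data.List.Properties using (++-assoc; ++-identityʳ; ++-conicalʳ; ∷-injectiveˡ)
open import Data.List.Membership.Propositional using (_∈_; find)
open import Data.List.Membership.Propositional.Properties
  using (∈-map⁺; ∈-map⁻; ∈-++⁺ˡ; ∈-++⁺ʳ; ∈-++⁻; ∈-concatMap⁻)
open import Data.List.Relation.Unary.All using (All; _∷_)
open import Data.List.Relation.Unary.Any using (here)
open import Data.List.Relation.Unary.Linked using (Linked; [-]; _∷_)
open import Data.List.Relation.Unary.AllPairs using (_∷_)
open import Data.Vec.Functional using (Vector; _++_)
open import Data.Vec.Functional.Properties using (lookup-++ˡ; lookup-++ʳ)
open import Data.Empty using (⊥; ⊥-elim)
open import Data.Unit using (tt)
open import Function.Bundles using (Inverse)
open import Relation.Nullary using (¬_)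
open import Relation.Binary.PropositionalEquality
  using (_≡_; _≢_; refl; sym; trans; cong; subst; module ≡-Reasoning)

↑ˡ≢↑ʳ : ∀ m {n} (a : Fin m) (b : Fin n) → a ↑ˡ n ≢ m ↑ʳ b
↑ˡ≢↑ʳ m {n} a b e with trans (sym (splitAt-↑ˡ m a n)) (trans (cong (splitAt m) e) (splitAt-↑ʳ m n b))
... | ()

module _ {n} (π : Perm n) where
  open Inverse π

  to-from : ∀ {i c} → from i ≡ c → i ≡ to c
  to-from {i} e = trans (sym (strictlyInverseˡ i)) (cong to e)

  to-injective : ∀ {a b} → to a ≡ to b → a ≡ b
  to-injective {a} {b} e = trans (sym (strictlyInverseʳ a)) (trans (cong from e) (strictlyInverseʳ b))

other : Dir → Dir
other lft = rgt
other rgt = lft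

dirCase : ∀ d d' → d' ≡ d ⊎ d' ≡ other d
dirCase lft lft = inj₁ refl
dirCase lft rgt = inj₂ refl
dirCase rgt lft = inj₂ refl
dirCase rgt rgt = inj₁ refl

other-≢ : ∀ d → other d ≢ d
other-≢ lft ()
other-≢ rgt ()

labF-notCut : ∀ A p → labF A p ≢ just cutL
labF-notCut (atom _ _) [] ()
labF-notCut (atom _ _) (_ ∷ _) ()
labF-notCut (_ ⊗ _) [] ()
labF-notCut (_ ⅋ _) [] ()
labF-notCut (_ ⊕ _) [] ()
labF-notCut (_ & _) [] ()
labF-notCut (A ⊗ B) (lft ∷ p) = labF-notCut A p
labF-notCut (A ⊗ B) (rgt ∷ p) = labF-notCut B p
labF-notCut (A ⅋ B) (lft ∷ p) = labF-notCut A p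
labF-notCut (A ⅋ B) (rgt ∷ p) = labF-notCut B p
labF-notCut (A ⊕ B) (lft ∷ p) = labF-notCut A p
labF-notCut (A ⊕ B) (rgt ∷ p) = labF-notCut B p
labF-notCut (A & B) (lft ∷ p) = labF-notCut A p
labF-notCut (A & B) (rgt ∷ p) = labF-notCut B p

lab-nonRoot-notCut : ∀ X d q → lab X (d ∷ q) ≢ just cutL
lab-nonRoot-notCut (fml A) d q = labF-notCut A (d ∷ q)
lab-nonRoot-notCut (cut A) lft q = labF-notCut A q
lab-nonRoot-notCut (cut A) rgt q = labF-notCut (dual A) q

NotCut : Item → Set
NotCut X = lab X [] ≢ just cutL

isCut-notNotCut : ∀ {X} → IsCut X → ¬ NotCut X
isCut-notNotCut (isCut A) nc = nc refl

labF-root : ∀ A → ∃ λ l → labF A [] ≡ just l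
labF-root (atom _ _) = _ , refl
labF-root (_ ⊗ _) = _ , refl
labF-root (_ ⅋ _) = _ , refl
labF-root (_ ⊕ _) = _ , refl
labF-root (_ & _) = _ , refl

lastFormula : ∀ {h} (Γ : Vector Item h) A →
              IsVertex (Γ ++ ⟦ fml A ⟧) (h ↑ʳ zero , []) × NotCut ((Γ ++ ⟦ fml A ⟧) (h ↑ʳ zero))
lastFormula Γ A rewrite lookup-++ʳ Γ ⟦ fml A ⟧ zero = labF-root A , labF-notCut A []

∈ₗ-map⁺ : ∀ {h n} (f : Vertex h → Vertex n) {b l} → b ∈ₗ l → trackLink f b ∈ₗ map (trackLink f) l
∈ₗ-map⁺ f (inj₁ b∈) = inj₁ (∈-map⁺ (trackLink f) b∈)
∈ₗ-map⁺ f (inj₂ b∈) = inj₂ (∈-map⁺ (trackLink f) b∈)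

∈ₗ-map⁻ : ∀ {h n} (f : Vertex h → Vertex n) {a l} → a ∈ₗ map (trackLink f) l →
          ∃ λ b → b ∈ₗ l × a ≡ trackLink f b
∈ₗ-map⁻ f (inj₁ a∈) with ∈-map⁻ (trackLink f) a∈
... | b , b∈ , refl = b , inj₁ b∈ , refl
∈ₗ-map⁻ f (inj₂ a∈) with ∈-map⁻ (trackLink f) a∈
... | (b₁ , b₂) , b∈ , refl = (b₂ , b₁) , inj₂ b∈ , refl

∈ₗ-++⁻ : ∀ {n} {a : Link n} xs {ys} → a ∈ₗ (xs List.++ ys) → a ∈ₗ xs ⊎ a ∈ₗ ys
∈ₗ-++⁻ xs (inj₁ a∈) = map⊎ inj₁ inj₁ (∈-++⁻ xs a∈)
∈ₗ-++⁻ xs (inj₂ a∈) = map⊎ inj₂ inj₂ (∈-++⁻ xs a∈)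

∈ₗ-++⁺ˡ : ∀ {n} {a : Link n} {xs ys} → a ∈ₗ xs → a ∈ₗ (xs List.++ ys)
∈ₗ-++⁺ˡ (inj₁ a∈) = inj₁ (∈-++⁺ˡ a∈)
∈ₗ-++⁺ˡ (inj₂ a∈) = inj₂ (∈-++⁺ˡ a∈)

∈ₗ-++⁺ʳ : ∀ {n} {a : Link n} xs {ys} → a ∈ₗ ys → a ∈ₗ (xs List.++ ys)
∈ₗ-++⁺ʳ xs (inj₁ a∈) = inj₁ (∈-++⁺ʳ xs a∈)
∈ₗ-++⁺ʳ xs (inj₂ a∈) = inj₂ (∈-++⁺ʳ xs a∈)

Covers : ∀ {h} → Vector Item h → List (List (Link h)) → Set
Covers Γ Ls = ∀ {l} → l ∈ Ls → ∀ i → NotCut (Γ i) →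
              ∃ λ b → b ∈ l × (proj₁ (proj₁ b) ≡ i ⊎ proj₁ (proj₂ b) ≡ i)

TogglesDifferences : ∀ {h} → Vector Item h → List (List (Link h)) → Set
TogglesDifferences Γ Ls = ∀ {l l' a} → l ∈ Ls → l' ∈ Ls → a ∈ₗ l → ¬ a ∈ₗ l' →
                          ∃ λ w → Toggled Γ (pairSet l l') w

PrefixMap : ∀ {h n} → (Vertex h → Vertex n) → Set
PrefixMap f = ∀ j p → f (j , p) ≡ (proj₁ (f (j , [])) , proj₂ (f (j , [])) List.++ p)

record IsEmbedding {h n} (Γ : Vector Item h) (Δ : Vector Item n) (f : Vertex h → Vertex n) : Set where
  field
    prefix : PrefixMap f
    labels : ∀ v → labelOf Δ (f v) ≡ labelOf Γ v

module Embedding {h n} {Γ : Vector Item h} {Δ : Vector Item n} {f : Vertex h → Vertex n}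
                 (emb : IsEmbedding Γ Δ f) where
  open IsEmbedding emb

  index : ∀ j p → proj₁ (f (j , p)) ≡ proj₁ (f (j , []))
  index j p = cong proj₁ (prefix j p)

  index-of : ∀ (x : Vertex h) {j} → proj₁ x ≡ j → proj₁ (f x) ≡ proj₁ (f (j , []))
  index-of (j , p) refl = index j p

  child⁺ : ∀ v d → f (child v d) ≡ child (f v) d
  child⁺ (j , p) d rewrite prefix j (p ∷ʳ d) | prefix j p =
    cong (λ q → (proj₁ (f (j , [])) , q)) (sym (++-assoc (proj₂ (f (j , []))) p (d ∷ [])))

  below⁺ : ∀ v x → Below Γ v x → Below Δ (f v) (f x)
  below⁺ (j , p) (.j , .(p List.++ r)) (refl , r , refl) rewrite prefix j p | prefix j (p List.++ r) =
    refl , r , sym (++-assoc (proj₂ (f (j , []))) p r)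

  isVertex⁺ : ∀ v → IsVertex Γ v → IsVertex Δ (f v)
  isVertex⁺ v (l , e) = l , trans (labels v) e

  isVertex⁻ : ∀ v → IsVertex Δ (f v) → IsVertex Γ v
  isVertex⁻ v (l , e) = l , trans (sym (labels v)) e

  image : ∀ u {v} → f u ≡ v → IsVertex Δ v → Σ (Vertex h) λ u → IsVertex Γ u × f u ≡ v
  image u refl iv = u , isVertex⁻ u iv , refl

  notCut⁻ : ∀ j → NotCut (Δ (proj₁ (f (j , [])))) → NotCut (Γ j)
  notCut⁻ j nc e = noCut (proj₂ (f (j , []))) (trans (labels (j , [])) e)
    where
    noCut : ∀ q → lab (Δ (proj₁ (f (j , [])))) q ≡ just cutL → ⊥
    noCut [] = nc
    noCut (d ∷ q) = lab-nonRoot-notCut (Δ (proj₁ (f (j , [])))) d q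

  root-inRestr : ∀ {Λ : LinkingSet n} {l₀ : List (Link h)} j → IsVertex Γ (j , []) →
                 Λ (map (trackLink f) l₀) → (∃ λ b → b ∈ l₀ × (proj₁ (proj₁ b) ≡ j ⊎ proj₁ (proj₂ b) ≡ j)) →
                 InRestr Δ Λ (f (j , []))
  root-inRestr j iv inΛ (b , b∈ , t) =
    isVertex⁺ _ iv , _ , inΛ , trackLink f b , ∈-map⁺ (trackLink f) b∈ ,
    map⊎ (belowRoot (proj₁ b)) (belowRoot (proj₂ b)) t
    where
    belowRoot : ∀ x → proj₁ x ≡ j → Below Δ (f (j , [])) (f x)
    belowRoot (_ , p) refl = below⁺ (j , []) (j , p) (refl , p , refl)

  module _ {l l' : List (Link h)} {L L' : List (Link n)}
           (incl : ∀ b → b ∈ l → trackLink f b ∈ L) (incl' : ∀ b → b ∈ l' → trackLink f b ∈ L') where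

    inRestr⁺ : ∀ v → InRestr Γ (pairSet l l') v → InRestr Δ (pairSet L L') (f v)
    inRestr⁺ v (iv , _ , inj₁ refl , a , a∈ , bl) =
      isVertex⁺ v iv , _ , inj₁ refl , trackLink f a , incl a a∈ , map⊎ (below⁺ v (proj₁ a)) (below⁺ v (proj₂ a)) bl
    inRestr⁺ v (iv , _ , inj₂ refl , a , a∈ , bl) =
      isVertex⁺ v iv , _ , inj₂ refl , trackLink f a , incl' a a∈ , map⊎ (below⁺ v (proj₁ a)) (below⁺ v (proj₂ a)) bl

    toggled⁺ : ∀ w → Toggled Γ (pairSet l l') w → Toggled Δ (pairSet L L') (f w)
    toggled⁺ w (iw , inL , inR) =
      trans (labels w) iw ,
      subst (InRestr Δ _) (child⁺ w lft) (inRestr⁺ _ inL) ,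
      subst (InRestr Δ _) (child⁺ w rgt) (inRestr⁺ _ inR)

  private
    Ls↑ : List (List (Link h)) → List (List (Link n))
    Ls↑ = map (map (trackLink f))

  toggles-map : ∀ Ls → TogglesDifferences Γ Ls → TogglesDifferences Δ (Ls↑ Ls)
  toggles-map Ls tog l∈ l'∈ a∈ a∉ with ∈-map⁻ (map (trackLink f)) l∈ | ∈-map⁻ (map (trackLink f)) l'∈
  ... | l₀ , l₀∈ , refl | l₀' , l₀'∈ , refl with ∈ₗ-map⁻ f a∈
  ... | b , b∈ , refl with tog l₀∈ l₀'∈ b∈ (λ b∈' → a∉ (∈ₗ-map⁺ f b∈'))
  ... | w , tg = f w , toggled⁺ (λ _ → ∈-map⁺ (trackLink f)) (λ _ → ∈-map⁺ (trackLink f)) w tg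

  touches⁺ : ∀ {l₀ : List (Link h)} {L} → (∀ b → b ∈ l₀ → trackLink f b ∈ L) →
             ∀ j → (∃ λ b → b ∈ l₀ × (proj₁ (proj₁ b) ≡ j ⊎ proj₁ (proj₂ b) ≡ j)) →
             ∃ λ b → b ∈ L × (proj₁ (proj₁ b) ≡ proj₁ (f (j , [])) ⊎ proj₁ (proj₂ b) ≡ proj₁ (f (j , [])))
  touches⁺ incl j (b , b∈ , inj₁ e) = trackLink f b , incl b b∈ , inj₁ (index-of (proj₁ b) e)
  touches⁺ incl j (b , b∈ , inj₂ e) = trackLink f b , incl b b∈ , inj₂ (index-of (proj₂ b) e)

  Onto : Set
  Onto = ∀ i → NotCut (Δ i) → ∃ λ j → proj₁ (f (j , [])) ≡ i

  covers-map : ∀ Ls → Covers Γ Ls → Onto → Covers Δ (Ls↑ Ls)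
  covers-map Ls cov onto l∈ i nc with ∈-map⁻ (map (trackLink f)) l∈
  ... | l₀ , l₀∈ , refl with onto i nc
  ... | j , refl = touches⁺ (λ _ → ∈-map⁺ (trackLink f)) j (cov l₀∈ j (notCut⁻ j nc))

join : ∀ {h₁ h₂ n} → (Vertex h₁ → Vertex n) → (Vertex h₂ → Vertex n) →
       List (List (Link h₁)) → List (List (Link h₂)) → List (List (Link n))
join fL fR Ls₁ Ls₂ = concatMap (λ l₁ → map (λ l₂ → map (trackLink fL) l₁ List.++
                                 map (trackLink fR) l₂) Ls₂) Ls₁

join⁻ : ∀ {h₁ h₂ n} (fL : Vertex h₁ → Vertex n) (fR : Vertex h₂ → Vertex n) Ls₁ Ls₂ {L} →
        L ∈ join fL fR Ls₁ Ls₂ → ∃ λ l₁ → ∃ λ l₂ → l₁ ∈ Ls₁ × l₂ ∈ Ls₂ ×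
        L ≡ map (trackLink fL) l₁ List.++ map (trackLink fR) l₂
join⁻ fL fR Ls₁ Ls₂ L∈ with find (∈-concatMap⁻ _ {xs = Ls₁} L∈)
... | l₁ , l₁∈ , L∈' with ∈-map⁻ _ L∈'
... | l₂ , l₂∈ , refl = l₁ , l₂ , l₁∈ , l₂∈ , refl

module Join {h₁ h₂ n} {Γ₁ : Vector Item h₁} {Γ₂ : Vector Item h₂} {Δ : Vector Item n}
            {fL : Vertex h₁ → Vertex n} {fR : Vertex h₂ → Vertex n}
            (embL : IsEmbedding Γ₁ Δ fL) (embR : IsEmbedding Γ₂ Δ fR)
            {Ls₁ : List (List (Link h₁))} {Ls₂ : List (List (Link h₂))} where
  module L = Embedding embL
  module R = Embedding embR

  -- a differing link comes from one premise, where the toggled vertex is found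
  toggled-in-premise :
    TogglesDifferences Γ₁ Ls₁ → TogglesDifferences Γ₂ Ls₂ →
    ∀ {l l' a} → l ∈ join fL fR Ls₁ Ls₂ → l' ∈ join fL fR Ls₁ Ls₂ → a ∈ₗ l → ¬ a ∈ₗ l' →
    (∃ λ b → a ≡ trackLink fL b × ∃ λ w → Toggled Δ (pairSet l l') (fL w)) ⊎
    (∃ λ b → a ≡ trackLink fR b × ∃ λ w → Toggled Δ (pairSet l l') (fR w))
  toggled-in-premise tog₁ tog₂ l∈ l'∈ a∈ a∉
    with join⁻ fL fR Ls₁ Ls₂ l∈ | join⁻ fL fR Ls₁ Ls₂ l'∈
  ... | l₁ , l₂ , l₁∈ , l₂∈ , refl | l₁' , l₂' , l₁'∈ , l₂'∈ , refl
    with ∈ₗ-++⁻ (map (trackLink fL) l₁) a∈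
  ... | inj₁ a∈₁ with ∈ₗ-map⁻ fL a∈₁
  ...   | b , b∈ , refl with tog₁ l₁∈ l₁'∈ b∈ (λ b∈' → a∉ (∈ₗ-++⁺ˡ (∈ₗ-map⁺ fL b∈')))
  ...     | w , tg = inj₁ (b , refl , w , L.toggled⁺ (λ _ x∈ → ∈-++⁺ˡ (∈-map⁺ (trackLink fL) x∈))
                                                   (λ _ x∈ → ∈-++⁺ˡ (∈-map⁺ (trackLink fL) x∈)) w tg)
  toggled-in-premise tog₁ tog₂ l∈ l'∈ a∈ a∉
    | l₁ , l₂ , l₁∈ , l₂∈ , refl | l₁' , l₂' , l₁'∈ , l₂'∈ , refl | inj₂ a∈₂ with ∈ₗ-map⁻ fR a∈₂
  ...   | b , b∈ , refl with tog₂ l₂∈ l₂'∈ b∈ (λ b∈' → a∉ (∈ₗ-++⁺ʳ (map (trackLink fL) l₁') (∈ₗ-map⁺ fR b∈')))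
  ...     | w , tg = inj₂ (b , refl , w , R.toggled⁺ (λ _ x∈ → ∈-++⁺ʳ (map (trackLink fL) l₁) (∈-map⁺ (trackLink fR) x∈))
                                                   (λ _ x∈ → ∈-++⁺ʳ (map (trackLink fL) l₁') (∈-map⁺ (trackLink fR) x∈)) w tg)

  toggles : TogglesDifferences Γ₁ Ls₁ → TogglesDifferences Γ₂ Ls₂ →
            TogglesDifferences Δ (join fL fR Ls₁ Ls₂)
  toggles tog₁ tog₂ l∈ l'∈ a∈ a∉ with toggled-in-premise tog₁ tog₂ l∈ l'∈ a∈ a∉
  ... | inj₁ (_ , _ , w , tg) = fL w , tg
  ... | inj₂ (_ , _ , w , tg) = fR w , tg

  covers : Covers Γ₁ Ls₁ → Covers Γ₂ Ls₂ →
           (∀ i → (∃ λ j → proj₁ (fL (j , [])) ≡ i) ⊎ (∃ λ j → proj₁ (fR (j , [])) ≡ i)) →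
           Covers Δ (join fL fR Ls₁ Ls₂)
  covers cov₁ cov₂ onto l∈ i nc with join⁻ fL fR Ls₁ Ls₂ l∈
  ... | l₁ , l₂ , l₁∈ , l₂∈ , refl with onto i
  ... | inj₁ (j , refl) =
    L.touches⁺ (λ _ x∈ → ∈-++⁺ˡ (∈-map⁺ (trackLink fL) x∈)) j (cov₁ l₁∈ j (L.notCut⁻ j nc))
  ... | inj₂ (j , refl) =
    R.touches⁺ (λ _ x∈ → ∈-++⁺ʳ (map (trackLink fL) l₁) (∈-map⁺ (trackLink fR) x∈)) j (cov₂ l₂∈ j (R.notCut⁻ j nc))

separates-root : ∀ {n} {Δ : Vector Item n} {Λ : LinkingSet n} {i Z} →
                 Δ i ≡ Z → SepBy Δ (lab Z []) Λ (i , []) → Separates Δ Λ (i , [])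
separates-root {Δ = Δ} {Λ} {i} e s = subst (λ Z → SepBy Δ (lab Z []) Λ (i , [])) (sym e) s

separates-⊕ : ∀ {n} {Δ : Vector Item n} {Λ : LinkingSet n} {v} d →
              ¬ InRestr Δ Λ (child v d) → SepBy Δ (just plusL) Λ v
separates-⊕ lft out = inj₁ out
separates-⊕ rgt out = inj₂ out

cycle-inRestr : ∀ {n} {Δ : Vector Item n} {Λ : LinkingSet n} {v} → CycleThrough Δ Λ v → InRestr Δ Λ v
cycle-inRestr (_ , _ , _ , (inΛ ∷ _) , _) = inΛ

separates-outside : ∀ {n} (Δ : Vector Item n) (Λ : LinkingSet n) v →
                    (∀ r → ¬ InRestr Δ Λ (proj₁ v , proj₂ v List.++ r)) → Compound Δ v → Separates Δ Λ v
separates-outside Δ Λ v out (iv , notLeaf) = outside (labelOf Δ v) refl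
  where
  self : ¬ InRestr Δ Λ v
  self inΛ = out [] (subst (λ p → InRestr Δ Λ (proj₁ v , p)) (sym (++-identityʳ (proj₂ v))) inΛ)
  outside : ∀ l → labelOf Δ v ≡ l → SepBy Δ l Λ v
  outside nothing e with trans (sym e) (proj₂ iv)
  ... | ()
  outside (just leafL) e = ⊥-elim (notLeaf e)
  outside (just parL) _ = tt
  outside (just withL) _ = tt
  outside (just plusL) _ = separates-⊕ {Δ = Δ} {Λ} lft (out (lft ∷ []))
  outside (just tensL) _ = λ cycle → self (cycle-inRestr {Δ = Δ} cycle)
  outside (just cutL) _ = λ cycle → self (cycle-inRestr {Δ = Δ} cycle)

atom-noCompound : ∀ {n} {Δ : Vector Item n} {i} q {b p} → Δ i ≡ fml (atom b p) → ¬ Compound Δ (i , q)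
atom-noCompound [] e (_ , notLeaf) = notLeaf (cong (λ Z → lab Z []) e)
atom-noCompound (d ∷ q) e ((_ , iv) , _) with trans (sym (cong (λ Z → lab Z (d ∷ q)) e)) iv
... | ()

axiom-noCompound : ∀ {Δ : Vector Item 2} p (π : Perm 2) →
                   Arr π Δ (⟦ fml (atom true p) ⟧ ++ ⟦ fml (atom false p) ⟧) → ∀ v → ¬ Compound Δ v
axiom-noCompound {Δ} p π arr (i , q) with Inverse.from π i in e
... | zero = atom-noCompound {Δ = Δ} q (trans (cong Δ (to-from π e)) (arr zero))
... | suc zero = atom-noCompound {Δ = Δ} q (trans (cong Δ (to-from π e)) (arr (suc zero)))

module Conclusion {m} {Γ : Vector Item m} {X : Item} {Δ : Vector Item (m + 1)}
                  (π : Perm (m + 1)) (arr : Arr π Δ (Γ ++ ⟦ X ⟧)) where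
  root : Fin (m + 1)
  root = Inverse.to π (m ↑ʳ zero)

  ctx : Fin m → Fin (m + 1)
  ctx c = Inverse.to π (c ↑ˡ 1)

  rootItem : Δ root ≡ X
  rootItem = trans (arr (m ↑ʳ zero)) (lookup-++ʳ Γ ⟦ X ⟧ zero)

  ctxItem : ∀ c → Δ (ctx c) ≡ Γ c
  ctxItem c = trans (arr (c ↑ˡ 1)) (lookup-++ˡ Γ ⟦ X ⟧ c)

  ctx≢root : ∀ c → ctx c ≢ root
  ctx≢root c e = ↑ˡ≢↑ʳ m c zero (to-injective π e)

  data Position (i : Fin (m + 1)) : Set where
    inContext : ∀ c → i ≡ ctx c → Position i
    principal : i ≡ root → Position i

  position : ∀ i → Position i
  position i with splitAt m (Inverse.from π i) in e
  ... | inj₁ c = inContext c (to-from π (sym (splitAt⁻¹-↑ˡ e)))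
  ... | inj₂ zero = principal (to-from π (sym (splitAt⁻¹-↑ʳ e)))

-- A rule with one premise Γ ++ ⟦ Y ⟧ whose Y becomes the d-argument of X
-- (the ⊕-rules).
module Unary {m} {Γ : Vector Item m} {X Y : Item} {Δ : Vector Item (m + 1)}
             (π : Perm (m + 1)) (d : Dir) (arr : Arr π Δ (Γ ++ ⟦ X ⟧))
             (argument : ∀ p → lab X (d ∷ p) ≡ lab Y p) where
  open Conclusion {Γ = Γ} {X} {Δ} π arr public

  f : Vertex (m + 1) → Vertex (m + 1)
  f = Track.unary m π d

  f-ctx : ∀ c p → f (c ↑ˡ 1 , p) ≡ (ctx c , p)
  f-ctx c p rewrite splitAt-↑ˡ m c 1 = refl

  f-principal : ∀ p → f (m ↑ʳ zero , p) ≡ (root , d ∷ p)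
  f-principal p rewrite splitAt-↑ʳ m 1 zero = refl

  embedding : IsEmbedding (Γ ++ ⟦ Y ⟧) Δ f
  embedding = record { prefix = prefix ; labels = labels }
    where
    prefix : PrefixMap f
    prefix j p with splitAt m j
    ... | inj₁ _ = refl
    ... | inj₂ _ = refl
    labels : ∀ v → labelOf Δ (f v) ≡ labelOf (Γ ++ ⟦ Y ⟧) v
    labels (j , p) with splitAt m j
    ... | inj₁ c = cong (λ Z → lab Z p) (ctxItem c)
    ... | inj₂ zero = trans (cong (λ Z → lab Z (d ∷ p)) rootItem) (argument p)

  preimage : ∀ i p → (∃ λ u → f u ≡ (i , p)) ⊎ (i ≡ root × (p ≡ [] ⊎ ∃ λ q → p ≡ other d ∷ q))
  preimage i p with position i
  ... | inContext c refl = inj₁ (_ , f-ctx c p)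
  preimage i [] | principal refl = inj₂ (refl , inj₁ refl)
  preimage i (d' ∷ q) | principal refl with dirCase d d'
  ... | inj₁ refl = inj₁ (_ , f-principal q)
  ... | inj₂ refl = inj₂ (refl , inj₂ (q , refl))

  onto : Embedding.Onto embedding
  onto i _ with position i
  ... | inContext c refl = c ↑ˡ 1 , cong proj₁ (f-ctx c [])
  ... | principal refl = m ↑ʳ zero , cong proj₁ (f-principal [])

  principal-image : ∀ u → proj₁ (f u) ≡ root → proj₂ (f u) ≡ d ∷ proj₂ u
  principal-image (j , p) e with splitAt m j
  ... | inj₁ c = ⊥-elim (ctx≢root c e)
  ... | inj₂ _ = refl

  unused-outside : ∀ Ls q → ¬ InRestr Δ (λ λ' → λ' ∈ map (map (trackLink f)) Ls) (root , other d ∷ q)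
  unused-outside Ls q (_ , _ , λ∈ , a , a∈ , bl) with ∈-map⁻ (map (trackLink f)) λ∈
  ... | _ , _ , refl with ∈-map⁻ (trackLink f) a∈
  ...   | b , _ , refl = [ notBelow (proj₁ b) , notBelow (proj₂ b) ]′ bl
    where
    notBelow : ∀ u → ¬ Below Δ (root , other d ∷ q) (f u)
    notBelow u (e , r , e') = other-≢ d (sym (∷-injectiveˡ (trans (sym (principal-image u (sym e))) e')))

  separates : ∀ Ls → lab X [] ≡ just plusL → ∀ v → IsVertex Δ v →
              ¬ (Σ (Vertex (m + 1)) λ u → IsVertex (Γ ++ ⟦ Y ⟧) u × f u ≡ v) → Compound Δ v →
              Separates Δ (λ λ' → λ' ∈ map (map (trackLink f)) Ls) v
  separates Ls isPlus (i , p) iv untracked comp with preimage i p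
  ... | inj₁ (u , e) = ⊥-elim (untracked (Embedding.image embedding u e iv))
  ... | inj₂ (refl , inj₁ refl) =
    subst (λ l → SepBy Δ l _ (root , [])) (sym (trans (cong (λ Z → lab Z []) rootItem) isPlus))
      (separates-⊕ {Δ = Δ} {v = (root , [])} (other d) (unused-outside Ls []))
  ... | inj₂ (refl , inj₂ (q , refl)) = separates-outside Δ _ _ (λ r → unused-outside Ls (q List.++ r)) comp

module Par {m} {Γ : Vector Item m} {A B : Formula} {Δ : Vector Item (m + 1)}
           (π : Perm (m + 1)) (arr : Arr π Δ (Γ ++ ⟦ fml (A ⅋ B) ⟧)) where
  open Conclusion {Γ = Γ} {fml (A ⅋ B)} {Δ} π arr public

  f : Vertex (m + 2) → Vertex (m + 1)
  f = Track.par m π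

  f-ctx : ∀ c p → f (c ↑ˡ 2 , p) ≡ (ctx c , p)
  f-ctx c p rewrite splitAt-↑ˡ m c 2 = refl

  f-principal : ∀ d p → ∃ λ u → f u ≡ (root , d ∷ p)
  f-principal lft p = (m ↑ʳ zero , p) , e
    where e : f (m ↑ʳ zero , p) ≡ (root , lft ∷ p)
          e rewrite splitAt-↑ʳ m 2 zero = refl
  f-principal rgt p = (m ↑ʳ suc zero , p) , e
    where e : f (m ↑ʳ suc zero , p) ≡ (root , rgt ∷ p)
          e rewrite splitAt-↑ʳ m 2 (suc zero) = refl

  embedding : IsEmbedding (Γ ++ (⟦ fml A ⟧ ++ ⟦ fml B ⟧)) Δ f
  embedding = record { prefix = prefix ; labels = labels }
    where
    prefix : PrefixMap f
    prefix j p with splitAt m {2} j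
    ... | inj₁ _ = refl
    ... | inj₂ zero = refl
    ... | inj₂ (suc _) = refl
    labels : ∀ v → labelOf Δ (f v) ≡ labelOf (Γ ++ (⟦ fml A ⟧ ++ ⟦ fml B ⟧)) v
    labels (j , p) with splitAt m {2} j
    ... | inj₁ c = cong (λ Z → lab Z p) (ctxItem c)
    ... | inj₂ zero = cong (λ Z → lab Z (lft ∷ p)) rootItem
    ... | inj₂ (suc zero) = cong (λ Z → lab Z (rgt ∷ p)) rootItem

  preimage : ∀ i p → (∃ λ u → f u ≡ (i , p)) ⊎ (i ≡ root × p ≡ [])
  preimage i p with position i
  ... | inContext c refl = inj₁ (_ , f-ctx c p)
  preimage i [] | principal refl = inj₂ (refl , refl)
  preimage i (d ∷ q) | principal refl = inj₁ (f-principal d q)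

  onto : Embedding.Onto embedding
  onto i _ with position i
  ... | inContext c refl = c ↑ˡ 2 , cong proj₁ (f-ctx c [])
  ... | principal refl with f-principal lft []
  ...   | (j , q) , e = j , trans (sym (Embedding.index embedding j q)) (cong proj₁ e)

  separates : ∀ {Λ} v → IsVertex Δ v →
              ¬ (Σ (Vertex (m + 2)) λ u → IsVertex (Γ ++ (⟦ fml A ⟧ ++ ⟦ fml B ⟧)) u × f u ≡ v) →
              Separates Δ Λ v
  separates (i , p) iv untracked with preimage i p
  ... | inj₁ (u , e) = ⊥-elim (untracked (Embedding.image embedding u e iv))
  ... | inj₂ (refl , refl) = separates-root rootItem tt

-- Every vertex of the
-- conclusion other than the root of X lies on the side of one premise.

data Side : Set where
  onLeft onRight atPrincipal : Side

sideOfPath : Path → Side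
sideOfPath [] = atPrincipal
sideOfPath (lft ∷ _) = onLeft
sideOfPath (rgt ∷ _) = onRight

sideOfPath-∷ʳ : ∀ p d → p ≢ [] → sideOfPath (p ∷ʳ d) ≡ sideOfPath p
sideOfPath-∷ʳ [] d ne = ⊥-elim (ne refl)
sideOfPath-∷ʳ (lft ∷ _) d _ = refl
sideOfPath-∷ʳ (rgt ∷ _) d _ = refl

sideOfPath-injective : ∀ d d' → sideOfPath (d ∷ []) ≡ sideOfPath (d' ∷ []) → d ≡ d'
sideOfPath-injective lft lft _ = refl
sideOfPath-injective lft rgt ()
sideOfPath-injective rgt lft ()
sideOfPath-injective rgt rgt _ = refl

lastOf : ∀ {A : Set} → A → List A → A
lastOf u [] = u
lastOf _ (u ∷ r) = lastOf u r

All-lastOf : ∀ {A : Set} {P : A → Set} u r → All P (u ∷ r) → P (lastOf u r)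
All-lastOf u [] (pu ∷ _) = pu
All-lastOf _ (u ∷ r) (_ ∷ ps) = All-lastOf u r ps

module Binary {m k} {Γ : Vector Item m} {Γ' : Vector Item k} {X Y₁ : Item}
              {Δ : Vector Item ((m + k) + 1)} (π : Perm ((m + k) + 1))
              (arr : Arr π Δ ((Γ ++ Γ') ++ ⟦ X ⟧))
              (leftArgument : ∀ p → lab X (lft ∷ p) ≡ lab Y₁ p) where
  open Conclusion {Γ = Γ ++ Γ'} {X} {Δ} π arr public

  x₀ : Vertex ((m + k) + 1)
  x₀ = (root , [])

  data Position₂ (i : Fin ((m + k) + 1)) : Set where
    inLeft : ∀ a → i ≡ ctx (a ↑ˡ k) → Position₂ i
    inRight : ∀ b → i ≡ ctx (m ↑ʳ b) → Position₂ i
    atRoot : i ≡ root → Position₂ i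

  position₂ : ∀ i → Position₂ i
  position₂ i with position i
  ... | principal e = atRoot e
  ... | inContext c e with splitAt m c in e'
  ...   | inj₁ a = inLeft a (trans e (cong ctx (sym (splitAt⁻¹-↑ˡ e'))))
  ...   | inj₂ b = inRight b (trans e (cong ctx (sym (splitAt⁻¹-↑ʳ e'))))

  side : Vertex ((m + k) + 1) → Side
  side (i , p) = [ (λ c → [ (λ _ → onLeft) , (λ _ → onRight) ]′ (splitAt m c)) , (λ _ → sideOfPath p) ]′
                 (splitAt (m + k) (Inverse.from π i))

  side-root : ∀ p → side (root , p) ≡ sideOfPath p
  side-root p rewrite Inverse.strictlyInverseʳ π ((m + k) ↑ʳ zero) | splitAt-↑ʳ (m + k) 1 zero = refl

  side-left : ∀ a p → side (ctx (a ↑ˡ k) , p) ≡ onLeft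
  side-left a p rewrite Inverse.strictlyInverseʳ π ((a ↑ˡ k) ↑ˡ 1)
                      | splitAt-↑ˡ (m + k) (a ↑ˡ k) 1 | splitAt-↑ˡ m a k = refl

  side-right : ∀ b p → side (ctx (m ↑ʳ b) , p) ≡ onRight
  side-right b p rewrite Inverse.strictlyInverseʳ π ((m ↑ʳ b) ↑ˡ 1)
                       | splitAt-↑ˡ (m + k) (m ↑ʳ b) 1 | splitAt-↑ʳ m k b = refl

  side-child : ∀ v d → v ≢ x₀ → side (child v d) ≡ side v
  side-child (i , p) d ne with position₂ i
  ... | inLeft a refl = trans (side-left a _) (sym (side-left a p))
  ... | inRight b refl = trans (side-right b _) (sym (side-right b p))
  ... | atRoot refl = trans (side-root (p ∷ʳ d))
                       (trans (sideOfPath-∷ʳ p d (λ e → ne (cong (root ,_) e))) (sym (side-root p)))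

  fL : Vertex (m + 1) → Vertex ((m + k) + 1)
  fL = Track.left m k π

  fL-ctx : ∀ a p → fL (a ↑ˡ 1 , p) ≡ (ctx (a ↑ˡ k) , p)
  fL-ctx a p rewrite splitAt-↑ˡ m a 1 = refl

  fL-principal : ∀ p → fL (m ↑ʳ zero , p) ≡ (root , lft ∷ p)
  fL-principal p rewrite splitAt-↑ʳ m 1 zero = refl

  embL : IsEmbedding (Γ ++ ⟦ Y₁ ⟧) Δ fL
  embL = record { prefix = prefix ; labels = labels }
    where
    prefix : PrefixMap fL
    prefix j p with splitAt m j
    ... | inj₁ _ = refl
    ... | inj₂ _ = refl
    labels : ∀ v → labelOf Δ (fL v) ≡ labelOf (Γ ++ ⟦ Y₁ ⟧) v
    labels (j , p) with splitAt m j
    ... | inj₁ a = cong (λ Z → lab Z p) (trans (ctxItem (a ↑ˡ k)) (lookup-++ˡ Γ Γ' a))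
    ... | inj₂ zero = trans (cong (λ Z → lab Z (lft ∷ p)) rootItem) (leftArgument p)

  side-fL : ∀ u → side (fL u) ≡ onLeft
  side-fL (j , p) with splitAt m j
  ... | inj₁ a = side-left a p
  ... | inj₂ _ = side-root (lft ∷ p)

  record RightPremise : Set where
    field
      {h} : ℕ
      Hyp : Vector Item h
      fR : Vertex h → Vertex ((m + k) + 1)
      embR : IsEmbedding Hyp Δ fR
      fR-ctx : ∀ b p → ∃ λ u → fR u ≡ (ctx (m ↑ʳ b) , p)
      fR-principal : ∀ p → ∃ λ u → fR u ≡ (root , rgt ∷ p)
      side-fR : ∀ u → side (fR u) ≡ onRight

  tensorPremise : ∀ {Y₂} → (∀ p → lab X (rgt ∷ p) ≡ lab Y₂ p) → RightPremise
  tensorPremise {Y₂} rightArgument = record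
    { Hyp = Γ' ++ ⟦ Y₂ ⟧ ; fR = fR ; embR = record { prefix = prefix ; labels = labels }
    ; fR-ctx = λ b p → (b ↑ˡ 1 , p) , fR-ctx b p
    ; fR-principal = λ p → (k ↑ʳ zero , p) , fR-principal p
    ; side-fR = side-fR }
    where
    fR = Track.tensRight m k π
    prefix : PrefixMap fR
    prefix j p with splitAt k j
    ... | inj₁ _ = refl
    ... | inj₂ _ = refl
    labels : ∀ v → labelOf Δ (fR v) ≡ labelOf (Γ' ++ ⟦ Y₂ ⟧) v
    labels (j , p) with splitAt k j
    ... | inj₁ b = cong (λ Z → lab Z p) (trans (ctxItem (m ↑ʳ b)) (lookup-++ʳ Γ Γ' b))
    ... | inj₂ zero = trans (cong (λ Z → lab Z (rgt ∷ p)) rootItem) (rightArgument p)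
    fR-ctx : ∀ b p → fR (b ↑ˡ 1 , p) ≡ (ctx (m ↑ʳ b) , p)
    fR-ctx b p rewrite splitAt-↑ˡ k b 1 = refl
    fR-principal : ∀ p → fR (k ↑ʳ zero , p) ≡ (root , rgt ∷ p)
    fR-principal p rewrite splitAt-↑ʳ k 1 zero = refl
    side-fR : ∀ u → side (fR u) ≡ onRight
    side-fR (j , p) with splitAt k j
    ... | inj₁ b = side-right b p
    ... | inj₂ _ = side-root (rgt ∷ p)

  cutPremise : ∀ {Y₂} → (∀ p → lab X (rgt ∷ p) ≡ lab Y₂ p) → RightPremise
  cutPremise {Y₂} rightArgument = record
    { Hyp = ⟦ Y₂ ⟧ ++ Γ' ; fR = fR ; embR = record { prefix = prefix ; labels = labels }
    ; fR-ctx = λ b p → (suc b , p) , refl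
    ; fR-principal = λ p → (zero , p) , refl
    ; side-fR = side-fR }
    where
    fR = Track.cutRight m k π
    prefix : PrefixMap fR
    prefix zero p = refl
    prefix (suc _) p = refl
    labels : ∀ v → labelOf Δ (fR v) ≡ labelOf (⟦ Y₂ ⟧ ++ Γ') v
    labels (zero , p) = trans (cong (λ Z → lab Z (rgt ∷ p)) rootItem) (rightArgument p)
    labels (suc b , p) = cong (λ Z → lab Z p) (trans (ctxItem (m ↑ʳ b)) (lookup-++ʳ Γ Γ' b))
    side-fR : ∀ u → side (fR u) ≡ onRight
    side-fR (zero , p) = side-root (rgt ∷ p)
    side-fR (suc b , p) = side-right b p

  module Premises (R : RightPremise) where
    open RightPremise R public

    preimage : ∀ i p → (∃ λ u → fL u ≡ (i , p)) ⊎ (∃ λ u → fR u ≡ (i , p)) ⊎ (i ≡ root × p ≡ [])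
    preimage i p with position₂ i
    ... | inLeft a refl = inj₁ (_ , fL-ctx a p)
    ... | inRight b refl = inj₂ (inj₁ (fR-ctx b p))
    preimage i [] | atRoot refl = inj₂ (inj₂ (refl , refl))
    preimage i (lft ∷ q) | atRoot refl = inj₁ (_ , fL-principal q)
    preimage i (rgt ∷ q) | atRoot refl = inj₂ (inj₁ (fR-principal q))

    onto : ∀ i → (∃ λ j → proj₁ (fL (j , [])) ≡ i) ⊎ (∃ λ j → proj₁ (fR (j , [])) ≡ i)
    onto i with position₂ i
    ... | inLeft a refl = inj₁ (a ↑ˡ 1 , cong proj₁ (fL-ctx a []))
    ... | atRoot refl = inj₁ (m ↑ʳ zero , cong proj₁ (fL-principal []))
    ... | inRight b refl with fR-ctx b []
    ...   | (j , q) , e = inj₂ (j , trans (sym (Embedding.index embR j q)) (cong proj₁ e))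

    module Acyclic {Ls₁ : List (List (Link (m + 1)))} {Ls₂ : List (List (Link h))}
                   (tog₁ : TogglesDifferences (Γ ++ ⟦ Y₁ ⟧) Ls₁) (tog₂ : TogglesDifferences Hyp Ls₂)
                   (tensorLike : lab X [] ≡ just tensL ⊎ lab X [] ≡ just cutL) where
      Λ : LinkingSet ((m + k) + 1)
      Λ λ' = λ' ∈ join fL fR Ls₁ Ls₂

      notWith : lab X [] ≢ just withL
      notWith e = notWith' tensorLike
        where
        notWith' : lab X [] ≡ just tensL ⊎ lab X [] ≡ just cutL → ⊥
        notWith' (inj₁ e') with trans (sym e') e
        ... | ()
        notWith' (inj₂ e') with trans (sym e') e
        ... | ()

      side-x₀ : side x₀ ≡ atPrincipal
      side-x₀ = side-root []

      OnSameSide : Vertex ((m + k) + 1) → Vertex ((m + k) + 1) → Set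
      OnSameSide u v = side u ≡ side v × side u ≢ atPrincipal × side v ≢ atPrincipal

      bothOn : ∀ {u v} s → side u ≡ s → side v ≡ s → s ≢ atPrincipal → OnSameSide u v
      bothOn _ e₁ e₂ ns = trans e₁ (sym e₂) , (λ e → ns (trans (sym e₁) e)) , (λ e → ns (trans (sym e₂) e))

      link-side : ∀ {a₁ a₂} → InUnion Δ Λ (a₁ , a₂) → OnSameSide a₁ a₂
      link-side (_ , λ∈ , a∈) with join⁻ fL fR Ls₁ Ls₂ λ∈
      ... | l₁ , _ , _ , _ , refl with ∈ₗ-++⁻ (map (trackLink fL) l₁) a∈
      ... | inj₁ a∈₁ with ∈ₗ-map⁻ fL a∈₁
      ...   | (u₁ , u₂) , _ , refl = bothOn onLeft (side-fL u₁) (side-fL u₂) (λ ())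
      link-side (_ , λ∈ , a∈) | l₁ , _ , _ , _ , refl | inj₂ a∈₂ with ∈ₗ-map⁻ fR a∈₂
      ...   | (u₁ , u₂) , _ , refl = bothOn onRight (side-fR u₁) (side-fR u₂) (λ ())

      -- the &-vertex a link depends on is toggled inside the link's premise
      jump-side : ∀ {ℓ ℓ' w} → Depends Δ Λ (ℓ , ℓ') w → side ℓ ≡ side w
      jump-side (_ , _ , λ₁∈ , λ₂∈ , a∈ , a∉ , _ , unique)
        with Join.toggled-in-premise embL embR tog₁ tog₂ λ₁∈ λ₂∈ a∈ a∉
      ... | inj₁ (b , refl , w , tg) = trans (side-fL (proj₁ b)) (trans (sym (side-fL w)) (cong side (unique _ tg)))
      ... | inj₂ (b , refl , w , tg) = trans (side-fR (proj₁ b)) (trans (sym (side-fR w)) (cong side (unique _ tg)))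

      edge-side : ∀ {u v} → u ≢ x₀ → Edge Δ Λ u v → side u ≡ side v
      edge-side ne (tree v d _ _) = sym (side-child v d ne)
      edge-side ne (link _ _ iu) = proj₁ (link-side iu)
      edge-side ne (jump _ _ _ _ dep) = jump-side dep

      adj-side : ∀ {u v} → u ≢ x₀ → v ≢ x₀ → Adj Δ Λ u v → side u ≡ side v
      adj-side nu nv (inj₁ e) = edge-side nu e
      adj-side nu nv (inj₂ e) = sym (edge-side nv e)

      edge-from-root : ∀ {u} → Edge Δ Λ x₀ u → ∃ λ d → u ≡ child x₀ d
      edge-from-root (tree _ d _ _) = d , refl
      edge-from-root (link _ _ iu) = ⊥-elim (proj₁ (proj₂ (link-side iu)) side-x₀)
      edge-from-root (jump _ _ _ iu _) = ⊥-elim (proj₁ (proj₂ (link-side iu)) side-x₀)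

      no-edge-into-root : ∀ {u y} → y ≡ x₀ → ¬ Edge Δ Λ u y
      no-edge-into-root e (tree v d _ _) with ++-conicalʳ (proj₂ v) (d ∷ []) (cong proj₂ e)
      ... | ()
      no-edge-into-root refl (link _ _ iu) = proj₂ (proj₂ (link-side iu)) side-x₀
      no-edge-into-root refl (jump _ _ _ _ (_ , _ , _ , _ , _ , _ , tg , _)) =
        notWith (trans (sym (cong (λ Z → lab Z []) rootItem)) (proj₁ tg))

      adj-root : ∀ {u} → Adj Δ Λ x₀ u ⊎ Adj Δ Λ u x₀ → ∃ λ d → u ≡ child x₀ d
      adj-root (inj₁ (inj₁ e)) = edge-from-root e
      adj-root (inj₁ (inj₂ e)) = ⊥-elim (no-edge-into-root refl e)
      adj-root (inj₂ (inj₁ e)) = ⊥-elim (no-edge-into-root refl e)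
      adj-root (inj₂ (inj₂ e)) = edge-from-root e

      walk : ∀ v r → All (x₀ ≢_) (v ∷ r) → Linked (Adj Δ Λ) (v ∷ (r ∷ʳ x₀)) →
             side (lastOf v r) ≡ side v × Adj Δ Λ (lastOf v r) x₀
      walk v [] _ (a ∷ [-]) = refl , a
      walk v (u ∷ r) (nv ∷ nu ∷ ns) (a ∷ lk) with walk u r (nu ∷ ns) lk
      ... | s , aₗ = trans s (sym (adj-side (λ e → nv (sym e)) (λ e → nu (sym e)) a)) , aₗ

      -- a cycle through x₀ leaves by one child and returns by a child on the
      -- same side, i.e. by the same child, contradicting simplicity
      acyclic : ¬ CycleThrough Δ Λ x₀
      acyclic ([] , () , _)
      acyclic ((_ ∷ []) , s≤s () , _)
      acyclic ((v ∷ u ∷ r) , _ , (notX ∷ (v∉ ∷ _)) , _ , (a₀ ∷ lk)) with walk v (u ∷ r) notX lk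
      ... | s , aₗ with adj-root (inj₁ a₀) | adj-root (inj₂ aₗ)
      ... | d₁ , e₁ | d₂ , e₂ =
        All-lastOf u r v∉ (trans e₁ (trans (cong (child x₀) d₁≡d₂) (sym e₂)))
        where
        open ≡-Reasoning
        d₁≡d₂ : d₁ ≡ d₂
        d₁≡d₂ = sideOfPath-injective d₁ d₂ (begin
          sideOfPath (d₁ ∷ [])        ≡⟨ side-root (d₁ ∷ []) ⟨
          side (child x₀ d₁)          ≡⟨ cong side e₁ ⟨
          side v                      ≡⟨ s ⟨
          side (lastOf u r)           ≡⟨ cong side e₂ ⟩
          side (child x₀ d₂)          ≡⟨ side-root (d₂ ∷ []) ⟩
          sideOfPath (d₂ ∷ [])        ∎)

      separates : ∀ v → IsVertex Δ v →
                  ¬ ((Σ _ λ u → IsVertex (Γ ++ ⟦ Y₁ ⟧) u × fL u ≡ v) ⊎ (Σ _ λ u → IsVertex Hyp u × fR u ≡ v)) →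
                  Separates Δ Λ v
      separates (i , p) iv untracked with preimage i p
      ... | inj₁ (u , e) = ⊥-elim (untracked (inj₁ (Embedding.image embL u e iv)))
      ... | inj₂ (inj₁ (u , e)) = ⊥-elim (untracked (inj₂ (Embedding.image embR u e iv)))
      ... | inj₂ (inj₂ (refl , refl)) = rootSeparates tensorLike
        where
        rootSeparates : lab X [] ≡ just tensL ⊎ lab X [] ≡ just cutL → Separates Δ Λ x₀
        rootSeparates (inj₁ e) = subst (λ l → SepBy Δ l Λ x₀) (sym (trans (cong (λ Z → lab Z []) rootItem) e)) acyclic
        rootSeparates (inj₂ e) = subst (λ l → SepBy Δ l Λ x₀) (sym (trans (cong (λ Z → lab Z []) rootItem) e)) acyclic

module With {o₁ o₂ m} {Ω₁ : Vector Item o₁} {Ω₂ : Vector Item o₂} {Γ : Vector Item m} {A B : Formula}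
            {Δ : Vector Item (((o₁ + o₂) + m) + 1)} (π : Perm (((o₁ + o₂) + m) + 1))
            (arr : Arr π Δ (((Ω₁ ++ Ω₂) ++ Γ) ++ ⟦ fml (A & B) ⟧)) where
  open Conclusion {Γ = (Ω₁ ++ Ω₂) ++ Γ} {fml (A & B)} {Δ} π arr public

  Hyp₁ : Vector Item ((o₁ + m) + 1)
  Hyp₁ = (Ω₁ ++ Γ) ++ ⟦ fml A ⟧

  Hyp₂ : Vector Item ((o₂ + m) + 1)
  Hyp₂ = (Ω₂ ++ Γ) ++ ⟦ fml B ⟧

  x₀ : Vertex (((o₁ + o₂) + m) + 1)
  x₀ = (root , [])

  inΩ₁ : Fin o₁ → Fin (((o₁ + o₂) + m) + 1)
  inΩ₁ a = ctx ((a ↑ˡ o₂) ↑ˡ m)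

  inΩ₂ : Fin o₂ → Fin (((o₁ + o₂) + m) + 1)
  inΩ₂ b = ctx ((o₁ ↑ʳ b) ↑ˡ m)

  inΓ : Fin m → Fin (((o₁ + o₂) + m) + 1)
  inΓ g = ctx ((o₁ + o₂) ↑ʳ g)

  itemΩ₁ : ∀ a → Δ (inΩ₁ a) ≡ Ω₁ a
  itemΩ₁ a = trans (ctxItem _) (trans (lookup-++ˡ (Ω₁ ++ Ω₂) Γ _) (lookup-++ˡ Ω₁ Ω₂ a))

  itemΩ₂ : ∀ b → Δ (inΩ₂ b) ≡ Ω₂ b
  itemΩ₂ b = trans (ctxItem _) (trans (lookup-++ˡ (Ω₁ ++ Ω₂) Γ _) (lookup-++ʳ Ω₁ Ω₂ b))

  itemΓ : ∀ g → Δ (inΓ g) ≡ Γ g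
  itemΓ g = trans (ctxItem _) (lookup-++ʳ (Ω₁ ++ Ω₂) Γ g)

  data Position₃ (i : Fin (((o₁ + o₂) + m) + 1)) : Set where
    atΩ₁ : ∀ a → i ≡ inΩ₁ a → Position₃ i
    atΩ₂ : ∀ b → i ≡ inΩ₂ b → Position₃ i
    atΓ : ∀ g → i ≡ inΓ g → Position₃ i
    atRoot : i ≡ root → Position₃ i

  position₃ : ∀ i → Position₃ i
  position₃ i with position i
  ... | principal e = atRoot e
  ... | inContext c e with splitAt (o₁ + o₂) c in e₁
  ...   | inj₂ g = atΓ g (trans e (cong ctx (sym (splitAt⁻¹-↑ʳ e₁))))
  ...   | inj₁ c' with splitAt o₁ c' in e₂
  ...     | inj₁ a = atΩ₁ a (trans e (cong ctx (trans (sym (splitAt⁻¹-↑ˡ e₁)) (cong (_↑ˡ m) (sym (splitAt⁻¹-↑ˡ e₂))))))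
  ...     | inj₂ b = atΩ₂ b (trans e (cong ctx (trans (sym (splitAt⁻¹-↑ˡ e₁)) (cong (_↑ˡ m) (sym (splitAt⁻¹-↑ʳ e₂))))))

  f₁ : Vertex ((o₁ + m) + 1) → Vertex (((o₁ + o₂) + m) + 1)
  f₁ = Track.with1 o₁ o₂ m π

  f₂ : Vertex ((o₂ + m) + 1) → Vertex (((o₁ + o₂) + m) + 1)
  f₂ = Track.with2 o₁ o₂ m π

  f₁-Ω : ∀ a p → f₁ ((a ↑ˡ m) ↑ˡ 1 , p) ≡ (inΩ₁ a , p)
  f₁-Ω a p rewrite splitAt-↑ˡ (o₁ + m) (a ↑ˡ m) 1 | splitAt-↑ˡ o₁ a m = refl

  f₁-Γ : ∀ g p → f₁ ((o₁ ↑ʳ g) ↑ˡ 1 , p) ≡ (inΓ g , p)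
  f₁-Γ g p rewrite splitAt-↑ˡ (o₁ + m) (o₁ ↑ʳ g) 1 | splitAt-↑ʳ o₁ m g = refl

  f₁-principal : ∀ p → f₁ ((o₁ + m) ↑ʳ zero , p) ≡ (root , lft ∷ p)
  f₁-principal p rewrite splitAt-↑ʳ (o₁ + m) 1 zero = refl

  f₂-Ω : ∀ b p → f₂ ((b ↑ˡ m) ↑ˡ 1 , p) ≡ (inΩ₂ b , p)
  f₂-Ω b p rewrite splitAt-↑ˡ (o₂ + m) (b ↑ˡ m) 1 | splitAt-↑ˡ o₂ b m = refl

  f₂-Γ : ∀ g p → f₂ ((o₂ ↑ʳ g) ↑ˡ 1 , p) ≡ (inΓ g , p)
  f₂-Γ g p rewrite splitAt-↑ˡ (o₂ + m) (o₂ ↑ʳ g) 1 | splitAt-↑ʳ o₂ m g = refl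

  f₂-principal : ∀ p → f₂ ((o₂ + m) ↑ʳ zero , p) ≡ (root , rgt ∷ p)
  f₂-principal p rewrite splitAt-↑ʳ (o₂ + m) 1 zero = refl

  emb₁ : IsEmbedding Hyp₁ Δ f₁
  emb₁ = record { prefix = prefix ; labels = labels }
    where
    prefix : PrefixMap f₁
    prefix j p with splitAt (o₁ + m) j
    ... | inj₂ _ = refl
    ... | inj₁ c with splitAt o₁ c
    ...   | inj₁ _ = refl
    ...   | inj₂ _ = refl
    labels : ∀ v → labelOf Δ (f₁ v) ≡ labelOf Hyp₁ v
    labels (j , p) with splitAt (o₁ + m) j
    ... | inj₂ zero = cong (λ Z → lab Z (lft ∷ p)) rootItem
    ... | inj₁ c with splitAt o₁ c
    ...   | inj₁ a = cong (λ Z → lab Z p) (itemΩ₁ a)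
    ...   | inj₂ g = cong (λ Z → lab Z p) (itemΓ g)

  emb₂ : IsEmbedding Hyp₂ Δ f₂
  emb₂ = record { prefix = prefix ; labels = labels }
    where
    prefix : PrefixMap f₂
    prefix j p with splitAt (o₂ + m) j
    ... | inj₂ _ = refl
    ... | inj₁ c with splitAt o₂ c
    ...   | inj₁ _ = refl
    ...   | inj₂ _ = refl
    labels : ∀ v → labelOf Δ (f₂ v) ≡ labelOf Hyp₂ v
    labels (j , p) with splitAt (o₂ + m) j
    ... | inj₂ zero = cong (λ Z → lab Z (rgt ∷ p)) rootItem
    ... | inj₁ c with splitAt o₂ c
    ...   | inj₁ b = cong (λ Z → lab Z p) (itemΩ₂ b)
    ...   | inj₂ g = cong (λ Z → lab Z p) (itemΓ g)

  preimage : ∀ i p → (∃ λ u → f₁ u ≡ (i , p)) ⊎ (∃ λ u → f₂ u ≡ (i , p)) ⊎ (i ≡ root × p ≡ [])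
  preimage i p with position₃ i
  ... | atΩ₁ a refl = inj₁ (_ , f₁-Ω a p)
  ... | atΩ₂ b refl = inj₂ (inj₁ (_ , f₂-Ω b p))
  ... | atΓ g refl = inj₁ (_ , f₁-Γ g p)
  preimage i [] | atRoot refl = inj₂ (inj₂ (refl , refl))
  preimage i (lft ∷ q) | atRoot refl = inj₁ (_ , f₁-principal q)
  preimage i (rgt ∷ q) | atRoot refl = inj₂ (inj₁ (_ , f₂-principal q))

  separates : ∀ {Λ} v → IsVertex Δ v →
              ¬ ((Σ _ λ u → IsVertex Hyp₁ u × f₁ u ≡ v) ⊎ (Σ _ λ u → IsVertex Hyp₂ u × f₂ u ≡ v)) →
              Separates Δ Λ v
  separates (i , p) iv untracked with preimage i p
  ... | inj₁ (u , e) = ⊥-elim (untracked (inj₁ (Embedding.image emb₁ u e iv)))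
  ... | inj₂ (inj₁ (u , e)) = ⊥-elim (untracked (inj₂ (Embedding.image emb₂ u e iv)))
  ... | inj₂ (inj₂ (refl , refl)) = separates-root rootItem tt

  -- each premise reaches all non-cut items: the cuts of the other Ω are the only gap
  onto₁ : (∀ b → IsCut (Ω₂ b)) → Embedding.Onto emb₁
  onto₁ cuts₂ i nc with position₃ i
  ... | atΩ₁ a refl = _ , cong proj₁ (f₁-Ω a [])
  ... | atΩ₂ b refl = ⊥-elim (isCut-notNotCut (cuts₂ b) (subst NotCut (itemΩ₂ b) nc))
  ... | atΓ g refl = _ , cong proj₁ (f₁-Γ g [])
  ... | atRoot refl = _ , cong proj₁ (f₁-principal [])

  onto₂ : (∀ a → IsCut (Ω₁ a)) → Embedding.Onto emb₂
  onto₂ cuts₁ i nc with position₃ i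
  ... | atΩ₁ a refl = ⊥-elim (isCut-notNotCut (cuts₁ a) (subst NotCut (itemΩ₁ a) nc))
  ... | atΩ₂ b refl = _ , cong proj₁ (f₂-Ω b [])
  ... | atΓ g refl = _ , cong proj₁ (f₂-Γ g [])
  ... | atRoot refl = _ , cong proj₁ (f₂-principal [])

  reaches₁ : ∀ {Ls₁ Λ l} → Covers Hyp₁ Ls₁ → l ∈ map (map (trackLink f₁)) Ls₁ → Λ l →
             InRestr Δ Λ (child x₀ lft)
  reaches₁ cov l∈ inΛ with ∈-map⁻ _ l∈
  ... | l₀ , l₀∈ , refl =
    subst (InRestr Δ _) (f₁-principal [])
      (Embedding.root-inRestr emb₁ _ (proj₁ principal₁) inΛ (cov l₀∈ _ (proj₂ principal₁)))
    where principal₁ = lastFormula (Ω₁ ++ Γ) A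

  reaches₂ : ∀ {Ls₂ Λ l} → Covers Hyp₂ Ls₂ → l ∈ map (map (trackLink f₂)) Ls₂ → Λ l →
             InRestr Δ Λ (child x₀ rgt)
  reaches₂ cov l∈ inΛ with ∈-map⁻ _ l∈
  ... | l₀ , l₀∈ , refl =
    subst (InRestr Δ _) (f₂-principal [])
      (Embedding.root-inRestr emb₂ _ (proj₁ principal₂) inΛ (cov l₀∈ _ (proj₂ principal₂)))
    where principal₂ = lastFormula (Ω₂ ++ Γ) B

  -- linkings of the same premise are handled there; linkings of different
  -- premises toggle A & B itself, since both premises reach its arguments
  toggles : ∀ {Ls₁ Ls₂} → TogglesDifferences Hyp₁ Ls₁ → TogglesDifferences Hyp₂ Ls₂ →
            Covers Hyp₁ Ls₁ → Covers Hyp₂ Ls₂ →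
            TogglesDifferences Δ (map (map (trackLink f₁)) Ls₁ List.++ map (map (trackLink f₂)) Ls₂)
  toggles {Ls₁} {Ls₂} tog₁ tog₂ cov₁ cov₂ l∈ l'∈ a∈ a∉
    with ∈-++⁻ (map (map (trackLink f₁)) Ls₁) l∈ | ∈-++⁻ (map (map (trackLink f₁)) Ls₁) l'∈
  ... | inj₁ x | inj₁ y = Embedding.toggles-map emb₁ Ls₁ tog₁ x y a∈ a∉
  ... | inj₂ x | inj₂ y = Embedding.toggles-map emb₂ Ls₂ tog₂ x y a∈ a∉
  ... | inj₁ x | inj₂ y = x₀ , isWith , reaches₁ cov₁ x (inj₁ refl) , reaches₂ cov₂ y (inj₂ refl)
    where isWith = cong (λ Z → lab Z []) rootItem
  ... | inj₂ x | inj₁ y = x₀ , isWith , reaches₁ cov₁ y (inj₂ refl) , reaches₂ cov₂ x (inj₁ refl)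
    where isWith = cong (λ Z → lab Z []) rootItem

  covers : ∀ {Ls₁ Ls₂} → (∀ a → IsCut (Ω₁ a)) → (∀ b → IsCut (Ω₂ b)) → Covers Hyp₁ Ls₁ → Covers Hyp₂ Ls₂ →
           Covers Δ (map (map (trackLink f₁)) Ls₁ List.++ map (map (trackLink f₂)) Ls₂)
  covers {Ls₁} {Ls₂} cuts₁ cuts₂ cov₁ cov₂ l∈ with ∈-++⁻ (map (map (trackLink f₁)) Ls₁) l∈
  ... | inj₁ x = Embedding.covers-map emb₁ Ls₁ cov₁ (onto₁ cuts₂) x
  ... | inj₂ x = Embedding.covers-map emb₂ Ls₂ cov₂ (onto₂ cuts₁) x

module Tensor {m k} {Γ : Vector Item m} {Γ' : Vector Item k} {A B : Formula}
              {Δ : Vector Item ((m + k) + 1)} (π : Perm ((m + k) + 1))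
              (arr : Arr π Δ ((Γ ++ Γ') ++ ⟦ fml (A ⊗ B) ⟧)) where
  open Binary {Γ = Γ} {Γ'} {fml (A ⊗ B)} {fml A} {Δ} π arr (λ _ → refl) public
  open Premises (tensorPremise {fml B} (λ _ → refl)) public

module Cut {m k} {Γ : Vector Item m} {Γ' : Vector Item k} {A : Formula}
           {Δ : Vector Item ((m + k) + 1)} (π : Perm ((m + k) + 1))
           (arr : Arr π Δ ((Γ ++ Γ') ++ ⟦ cut A ⟧)) where
  open Binary {Γ = Γ} {Γ'} {cut A} {fml A} {Δ} π arr (λ _ → refl) public
  open Premises (cutPremise {fml (dual A)} (λ _ → refl)) public

covers : ∀ {n} {Δ : Vector Item n} (P : Proof Δ) → Covers Δ (linkings P)
covers (axR p π arr) (here refl) i _ with Inverse.from π i in e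
... | zero = _ , here refl , inj₁ (sym (to-from π e))
... | suc zero = _ , here refl , inj₂ (sym (to-from π e))
covers (parR {Γ = Γ} {A} {B} {Δ} π arr P) = Embedding.covers-map R.embedding _ (covers P) R.onto
  where module R = Par {Γ = Γ} {A} {B} {Δ} π arr
covers (plus1R {Γ = Γ} {A} {B} {Δ} π arr P) = Embedding.covers-map R.embedding _ (covers P) R.onto
  where module R = Unary {Γ = Γ} {fml (A ⊕ B)} {fml A} {Δ} π lft arr (λ _ → refl)
covers (plus2R {Γ = Γ} {A} {B} {Δ} π arr P) = Embedding.covers-map R.embedding _ (covers P) R.onto
  where module R = Unary {Γ = Γ} {fml (A ⊕ B)} {fml B} {Δ} π rgt arr (λ _ → refl)
covers (withR {Ω₁ = Ω₁} {Ω₂} {Γ} {A} {B} {Δ} π cuts₁ cuts₂ arr P Q) = R.covers cuts₁ cuts₂ (covers P) (covers Q)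
  where module R = With {Ω₁ = Ω₁} {Ω₂} {Γ} {A} {B} {Δ} π arr
covers (tensR {Γ = Γ} {Γ'} {A} {B} {Δ} π arr P Q) = Join.covers R.embL R.embR (covers P) (covers Q) R.onto
  where module R = Tensor {Γ = Γ} {Γ'} {A} {B} {Δ} π arr
covers (cutR {Γ = Γ} {Γ'} {A} {Δ} π arr P Q) = Join.covers R.embL R.embR (covers P) (covers Q) R.onto
  where module R = Cut {Γ = Γ} {Γ'} {A} {Δ} π arr

toggles : ∀ {n} {Δ : Vector Item n} (P : Proof Δ) → TogglesDifferences Δ (linkings P)
toggles (axR p π arr) (here refl) (here refl) a∈ a∉ = ⊥-elim (a∉ a∈)
toggles (parR {Γ = Γ} {A} {B} {Δ} π arr P) = Embedding.toggles-map R.embedding _ (toggles P)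
  where module R = Par {Γ = Γ} {A} {B} {Δ} π arr
toggles (plus1R {Γ = Γ} {A} {B} {Δ} π arr P) = Embedding.toggles-map R.embedding _ (toggles P)
  where module R = Unary {Γ = Γ} {fml (A ⊕ B)} {fml A} {Δ} π lft arr (λ _ → refl)
toggles (plus2R {Γ = Γ} {A} {B} {Δ} π arr P) = Embedding.toggles-map R.embedding _ (toggles P)
  where module R = Unary {Γ = Γ} {fml (A ⊕ B)} {fml B} {Δ} π rgt arr (λ _ → refl)
toggles (withR {Ω₁ = Ω₁} {Ω₂} {Γ} {A} {B} {Δ} π _ _ arr P Q) =
  R.toggles (toggles P) (toggles Q) (covers P) (covers Q)
  where module R = With {Ω₁ = Ω₁} {Ω₂} {Γ} {A} {B} {Δ} π arr
toggles (tensR {Γ = Γ} {Γ'} {A} {B} {Δ} π arr P Q) = Join.toggles R.embL R.embR (toggles P) (toggles Q)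
  where module R = Tensor {Γ = Γ} {Γ'} {A} {B} {Δ} π arr
toggles (cutR {Γ = Γ} {Γ'} {A} {Δ} π arr P Q) = Join.toggles R.embL R.embR (toggles P) (toggles Q)
  where module R = Cut {Γ = Γ} {Γ'} {A} {Δ} π arr

lemma4 : ∀ {n : ℕ} {Δ : Vector Item n} (P : Proof Δ) (v : Vertex n) →
         Generated P v → Compound Δ v → Separates Δ (θ P) v
lemma4 {Δ = Δ} (axR p π arr) v _ comp = ⊥-elim (axiom-noCompound {Δ} p π arr v comp)
lemma4 (parR {Γ = Γ} {A} {B} {Δ} π arr P) v (iv , untracked) _ = R.separates v iv untracked
  where module R = Par {Γ = Γ} {A} {B} {Δ} π arr
lemma4 (withR {Ω₁ = Ω₁} {Ω₂} {Γ} {A} {B} {Δ} π _ _ arr P Q) v (iv , untracked) _ = R.separates v iv untracked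
  where module R = With {Ω₁ = Ω₁} {Ω₂} {Γ} {A} {B} {Δ} π arr
lemma4 (plus1R {Γ = Γ} {A} {B} {Δ} π arr P) v (iv , untracked) comp =
  R.separates (linkings P) refl v iv untracked comp
  where module R = Unary {Γ = Γ} {fml (A ⊕ B)} {fml A} {Δ} π lft arr (λ _ → refl)
lemma4 (plus2R {Γ = Γ} {A} {B} {Δ} π arr P) v (iv , untracked) comp =
  R.separates (linkings P) refl v iv untracked comp
  where module R = Unary {Γ = Γ} {fml (A ⊕ B)} {fml B} {Δ} π rgt arr (λ _ → refl)
lemma4 (tensR {Γ = Γ} {Γ'} {A} {B} {Δ} π arr P Q) v (iv , untracked) _ = R.separates v iv untracked
  where module R = Tensor.Acyclic {Γ = Γ} {Γ'} {A} {B} {Δ} π arr (toggles P) (toggles Q) (inj₁ refl)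
lemma4 (cutR {Γ = Γ} {Γ'} {A} {Δ} π arr P Q) v (iv , untracked) _ = R.separates v iv untracked
  where module R = Cut.Acyclic {Γ = Γ} {Γ'} {A} {Δ} π arr (toggles P) (toggles Q) (inj₂ refl)
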